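{- Let $\mathsf{JL}$ be a propositional justification logic (as described in the context) whose axioms include the scheme $\mathrm{jT}$: $t:A\rightarrow A$. Then $\mathsf{JL}(\mathsf{FP})_{\mathcal{TCS}}$, the fixed point extension of $\mathsf{JL}$ with the total constant specification, is inconsistent (it proves $\bot$).
   Context: Justification terms are built from justification variables $x,y,\dots$ and justification constants $c,\dots$ using binary application $\cdot$, binary sum $+$, and, depending on the logic, unary operations $!$, $?$, $\bar{?}$. Formulas: $A::= p\mid\bot\mid\neg A\mid A\wedge A\mid A\vee A\mid A\rightarrow A\mid t:A$, with $p$ a propositional variable and $t$ a term. The basic logic $\mathsf{J}$ has axioms: all propositional tautologies; Sum: $s:A\rightarrow(s+t):A$, $s:A\rightarrow(t+s):A$; jK: $s:(A\rightarrow B)\rightarrow(t:A\rightarrow(s\cdot t):B)$. A justification logic $\mathsf{JL}$ is obtained by adding to $\mathsf{J}$ some of: jT: $t:A\rightarrow A$; jD: $t:\bot\rightarrow\bot$; j4: $t:A\rightarrow !t:t:A$; jB: $\neg A\rightarrow\bar{?}t:\neg t:A$; j5: $\neg t:A\rightarrow ?t:\neg t:A$ (the language contains exactly the term operations occurring in its axioms). Rules: Modus Ponens and Iterated Axiom Necessitation (IAN): $\vdash c_{i_n}:c_{i_{n-1}}:\dots:c_{i_1}:A$ for any axiom instance $A$, any constants $c_{i_j}$, $n\ge1$. The total constant specification $\mathcal{TCS}$ is the set of all formulas produced by IAN; for a subset $\mathcal{CS}$ of it, $\mathsf{JL}_{\mathcal{CS}}$ is the logic in which IAN only produces members of $\mathcal{CS}$.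 Fixed point extension: an occurrence of $p$ in a formula $A(p,q_1,\dots,q_n)$ is justified if it lies in the scope of some justification operator $t:$. The language $\mathcal{L}(\mathsf{FP})$ extends the language by an $n$-ary operator $\delta_A$ for each formula $A(p,q_1,\dots,q_n)$ in which every occurrence of $p$ is justified, and $\mathsf{JL}(\mathsf{FP})$ adds to $\mathsf{JL}$ (with all schemes now ranging over $\mathcal{L}(\mathsf{FP})$) the fixed point axioms $\delta_A(B_1,\dots,B_n)\leftrightarrow A(\delta_A(B_1,\dots,B_n),B_1,\dots,B_n)$ for all $\mathcal{L}(\mathsf{FP})$-formulas $B_i$. Constant specifications and $\mathsf{JL}(\mathsf{FP})_{\mathcal{CS}}$ are defined as for $\mathsf{JL}$, with axiom instances of $\mathsf{JL}(\mathsf{FP})$ (so $\mathcal{TCS}$ consists of all $c_{i_n}:\dots:c_{i_1}:A$ with $A$ an axiom instance of $\mathsf{JL}(\mathsf{FP})$). -}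

module Defs where

open import Data.Bool using (Bool; true; false; T; not; _∧_; _∨_)
open import Data.Nat using (ℕ)
open import Data.Fin using (Fin; zero; suc)
open import Data.Vec using (Vec; lookup)
open import Data.Unit using (⊤)
open import Data.Empty using (⊥)
open import Data.Product using (_×_)
open import Relation.Binary.PropositionalEquality using (_≡_; _≢_)

record Logic : Set where
  field
    hasT hasD has4 hasB has5 : Bool
open Logic public

module _ (L : Logic) where

  -- Justification terms.  The operations !, ?, ?̄ are present exactly when
  -- the corresponding axiom (j4, j5, jB) is part of the logic.
  data Term : Set where
    jvar   : ℕ → Term
    jconst : ℕ → Term
    _·_    : Term → Term → Term
    _⊕_    : Term → Term → Term
    !_     : {{T (has4 L)}} → Term → Term
    ¿_     : {{T (has5 L)}} → Term → Term
    ¿̄_     : {{T (hasB L)}} → Term → Term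

  data Fm (V : Set) : Set where
    pv   : V → Fm V
    fbot : Fm V
    fneg : Fm V → Fm V
    fand for fimp : Fm V → Fm V → Fm V
    fjus : Term → Fm V → Fm V

  -- A(p,q₁,…,qₙ) is a base formula over variables Fin (suc n), with
  -- p = zero and qᵢ = suc (i-1).  "Every occurrence of p is justified":
  Justified : ∀ {n} → Fm (Fin (ℕ.suc n)) → Set
  Justified (pv i)     = i ≢ zero
  Justified fbot       = ⊤
  Justified (fneg A)   = Justified A
  Justified (fand A B) = Justified A × Justified B
  Justified (for A B)  = Justified A × Justified B
  Justified (fimp A B) = Justified A × Justified B
  Justified (fjus t A) = ⊤

  data FFm : Set where
    var  : ℕ → FFm
    ⊥'   : FFm
    ¬'_  : FFm → FFm
    _∧'_ _∨'_ _⇒_ : FFm → FFm → FFm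
    _∶_  : Term → FFm → FFm
    δ    : (n : ℕ) (A : Fm (Fin (ℕ.suc n))) → Justified A → Vec FFm n → FFm

  _⇔_ : FFm → FFm → FFm
  A ⇔ B = (A ⇒ B) ∧' (B ⇒ A)

  subst : ∀ {V} → (V → FFm) → Fm V → FFm
  subst σ (pv x)     = σ x
  subst σ fbot       = ⊥'
  subst σ (fneg A)   = ¬' subst σ A
  subst σ (fand A B) = subst σ A ∧' subst σ B
  subst σ (for A B)  = subst σ A ∨' subst σ B
  subst σ (fimp A B) = subst σ A ⇒ subst σ B
  subst σ (fjus t A) = t ∶ subst σ A

  eval : (FFm → Bool) → FFm → Bool
  eval v ⊥'       = false
  eval v (¬' A)   = not (eval v A)
  eval v (A ∧' B) = eval v A ∧ eval v B
  eval v (A ∨' B) = eval v A ∨ eval v B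
  eval v (A ⇒ B)  = not (eval v A) ∨ eval v B
  eval v A        = v A

  Tautology : FFm → Set
  Tautology A = (v : FFm → Bool) → eval v A ≡ true

  data Axiom : FFm → Set where
    taut : ∀ {A} → Tautology A → Axiom A
    sumˡ : ∀ s t A → Axiom ((s ∶ A) ⇒ ((s ⊕ t) ∶ A))
    sumʳ : ∀ s t A → Axiom ((s ∶ A) ⇒ ((t ⊕ s) ∶ A))
    jK   : ∀ s t A B → Axiom ((s ∶ (A ⇒ B)) ⇒ ((t ∶ A) ⇒ ((s · t) ∶ B)))
    jT   : {{T (hasT L)}} → ∀ t A → Axiom ((t ∶ A) ⇒ A)
    jD   : {{T (hasD L)}} → ∀ t → Axiom ((t ∶ ⊥') ⇒ ⊥')
    j4   : {{_ : T (has4 L)}} → ∀ t A → Axiom ((t ∶ A) ⇒ ((! t) ∶ (t ∶ A)))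
    jB   : {{_ : T (hasB L)}} → ∀ t A → Axiom ((¬' A) ⇒ ((¿̄ t) ∶ (¬' (t ∶ A))))
    j5   : {{_ : T (has5 L)}} → ∀ t A → Axiom ((¬' (t ∶ A)) ⇒ ((¿ t) ∶ (¬' (t ∶ A))))
    fp   : ∀ n A (j : Justified A) (Bs : Vec FFm n) →
           Axiom (δ n A j Bs ⇔ subst (λ { zero → δ n A j Bs ; (suc i) → lookup Bs i }) A)

  data TCS : FFm → Set where
    base : ∀ i {A} → Axiom A → TCS (jconst i ∶ A)
    step : ∀ i {F} → TCS F → TCS (jconst i ∶ F)

  data Prf (CS : FFm → Set) : FFm → Set where
    ax  : ∀ {A} → Axiom A → Prf CS A
    mp  : ∀ {A B} → Prf CS (A ⇒ B) → Prf CS A → Prf CS B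
    ian : ∀ {F} → CS F → Prf CS F

module Submission where

-- Fix the term s = (c · c) · c, c = jconst 0, and let D be the fixed point
-- δ_A of A(p) = ¬ s:p, so that JL(FP) proves D ↔ ¬ s:D.  The total constant
-- specification lets us internalise the classical argument "from s:D ⇒ D
-- and the fixed point axiom, D follows": c justifies the fixed point axiom,
-- the reflection instance s:D ⇒ D of jT, and the tautology linking them, so
-- two applications of jK yield s:D, with exactly the term s.  Reflection then
-- gives D, hence ¬ s:D by the fixed point axiom, contradicting s:D.

open import Defs
open import Data.Bool using (T; true; false)
open import Data.Unit using (tt)
open import Data.Vec using ([])
open import Data.Fin using (Fin; zero)
open import Relation.Binary.PropositionalEquality using (refl)

module _ {L : Logic} {CS : FFm L → Set} where

  mp₂ : ∀ {A B C} → Prf L CS (A ⇒ (B ⇒ C)) → Prf L CS A → Prf L CS B → Prf L CS C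
  mp₂ A⇒B⇒C a b = mp (mp A⇒B⇒C a) b

  apply : ∀ {s t A B} → Prf L CS (s ∶ (A ⇒ B)) → Prf L CS (t ∶ A) → Prf L CS ((s · t) ∶ B)
  apply {s} {t} {A} {B} = mp₂ (ax (jK s t A B))

necessitate : ∀ {L A} i → Axiom L A → Prf L (TCS L) (jconst i ∶ A)
necessitate i a = ian (base i a)

module _ {L : Logic} (X Y : FFm L) where

  liar-reflection-tautology : Tautology L (_⇔_ L X (¬' Y) ⇒ ((Y ⇒ X) ⇒ X))
  liar-reflection-tautology v with eval L v X | eval L v Y
  ... | true  | true  = refl
  ... | true  | false = refl
  ... | false | true  = refl
  ... | false | false = refl

  liar-contradiction-tautology : Tautology L (_⇔_ L X (¬' Y) ⇒ (X ⇒ (Y ⇒ ⊥')))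
  liar-contradiction-tautology v with eval L v X | eval L v Y
  ... | true  | true  = refl
  ... | true  | false = refl
  ... | false | true  = refl
  ... | false | false = refl

module Liar {L : Logic} (s : Term L) where

  -- A(p) = ¬ s:p; its only occurrence of p is under s:, so δ_A exists.
  liarSchema : Fm L (Fin 1)
  liarSchema = fneg (fjus s (pv zero))

  liar : FFm L
  liar = δ 0 liarSchema tt []

  liar-fixed-point : Axiom L (_⇔_ L liar (¬' (s ∶ liar)))
  liar-fixed-point = fp 0 liarSchema tt []

  liar-unjustifiable : {{T (hasT L)}} → ∀ {CS} → Prf L CS (s ∶ liar) → Prf L CS ⊥'
  liar-unjustifiable s∶D =
    mp₂ (mp (ax (taut (liar-contradiction-tautology liar (s ∶ liar)))) (ax liar-fixed-point))
        (mp (ax (jT s liar)) s∶D)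
        s∶D

liarTerm : ∀ {L} → Term L
liarTerm = (jconst 0 · jconst 0) · jconst 0

liar-justified : ∀ {L} {{_ : T (hasT L)}} → Prf L (TCS L) (liarTerm ∶ Liar.liar liarTerm)
liar-justified {L} =
  apply (apply (necessitate 0 (taut (liar-reflection-tautology liar (liarTerm ∶ liar))))
               (necessitate 0 liar-fixed-point))
        (necessitate 0 (jT liarTerm liar))
  where open Liar {L} liarTerm

theorem18 : (L : Logic) → T (hasT L) → Prf L (TCS L) (⊥' {L})
theorem18 L reflection = liar-unjustifiable {{reflection}} (liar-justified {{reflection}})
  where open Liar {L} liarTerm
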